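{- For every integer $k\ge 4$, there is a $(k+1)$-NL-coloring of the cycle $C_{\ell(k)-1}$, where $\ell(k)=\frac{k^3-k^2}{2}$.
   Context: A $k$-coloring of a graph $G$ is a partition of $V(G)$ into $k$ independent sets (colors). A coloring $\{S_1,\dots,S_k\}$ is neighbor-locating (a $k$-NL-coloring) if for any two distinct vertices $u,v$ in the same color class, $\{j: N(u)\cap S_j\neq\emptyset\}\neq\{j: N(v)\cap S_j\neq\emptyset\}$. -}

module Defs where

open import Data.Nat using (ℕ; zero; suc; _+_; _*_; _∸_; _^_; _/_)
open import Data.Fin using (Fin; toℕ)
open import Data.Product using (∃; _×_)
open import Data.Sum using (_⊎_)
open import Data.Nat.DivMod using (_%_)
open import Relation.Binary.PropositionalEquality using (_≡_)
open import Relation.Nullary using (¬_)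
open import Function.Definitions using (Surjective)

-- The cycle C_n on vertex set Fin n (intended for n ≥ 3):
-- i and j are adjacent iff j ≡ i+1 (mod n) or i ≡ j+1 (mod n).
CycleAdj : (n : ℕ) → Fin n → Fin n → Set
CycleAdj (suc n) i j =
  (toℕ j ≡ (suc (toℕ i)) % (suc n)) ⊎ (toℕ i ≡ (suc (toℕ j)) % (suc n))
CycleAdj zero () j

-- A graph on a vertex set V, given by its adjacency relation.
-- c : V → Fin k is a k-coloring: a partition of V into k (nonempty)
-- independent sets S_1..S_k, S_j = c⁻¹(j).
IsColoring : {V : Set} (adj : V → V → Set) (k : ℕ) (c : V → Fin k) → Set
IsColoring {V} adj k c =
  Surjective _≡_ _≡_ c × (∀ (u v : V) → adj u v → ¬ (c u ≡ c v))

NbrColor : {V : Set} (adj : V → V → Set) {k : ℕ} (c : V → Fin k) → V → Fin k → Set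
NbrColor {V} adj c u j = ∃ λ w → adj u w × c w ≡ j

SameNbrColors : {V : Set} (adj : V → V → Set) {k : ℕ} (c : V → Fin k) → V → V → Set
SameNbrColors adj {k} c u v =
  ∀ (j : Fin k) → (NbrColor adj c u j → NbrColor adj c v j) × (NbrColor adj c v j → NbrColor adj c u j)

IsNLColoring : {V : Set} (adj : V → V → Set) (k : ℕ) (c : V → Fin k) → Set
IsNLColoring {V} adj k c =
  IsColoring adj k c ×
  (∀ (u v : V) → ¬ (u ≡ v) → c u ≡ c v → ¬ SameNbrColors adj c u v)

ℓ : ℕ → ℕ
ℓ k = ((k ^ 3) ∸ (k ^ 2)) / 2

module Submission where

-- A colouring of C_n is a cyclic word of length n.  The module CyclicWord
-- shows that a cyclic word over {0, …, m−1} is an NL m-colouring as soon as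
-- (i) consecutive letters differ, (ii) every letter occurs, and (iii) every
-- position is determined by its letter together with the unordered pair of
-- letters around it.
--
-- The module Construction builds such a word over {0, …, k}: the orbit of an
-- explicit successor function on states (p, q, r, slot) with p < q < r ≤ k.
-- An invariant (Valid) and a potential (remaining: the letters left until the
-- end of the cycle, which drops by one per step) show that the orbit closes
-- after exactly n steps without repeating a state; a decoder recovers each
-- state from its letter and neighbour pair, which gives (iii).

open import Defs
open import Data.Nat using (ℕ; zero; suc; pred; _+_; _*_; _∸_; _≤_; _<_; _≥_; z≤n; s≤s; s≤s⁻¹; _⊓_; _⊔_; _^_; _/_; _≟_; _<?_; _≤?_)
open import Data.Nat.Properties
open import Data.Nat.DivMod using (_%_; m%n<n; m<n⇒m%n≡m; n%n≡0; m*n/n≡m)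
open import Data.Nat.Tactic.RingSolver using (solve-∀; solve)
open import Data.Bool using (Bool; true; false; if_then_else_)
open import Data.Fin using (Fin; toℕ; fromℕ<)
open import Data.Fin.Properties using (toℕ<n; toℕ-fromℕ<; toℕ-injective)
open import Data.List using (_∷_; [])
open import Data.Product using (∃; _×_; _,_; proj₁; proj₂)
open import Data.Sum using (_⊎_; inj₁; inj₂)
open import Data.Empty using (⊥-elim)
open import Function using (_∘_)
open import Relation.Binary.PropositionalEquality
open import Relation.Nullary using (¬_; yes; no; does; contradiction)
open import Relation.Nullary.Decidable using (dec-true; dec-false; _×-dec_; toSum)

Among : ℕ → ℕ → ℕ → Set
Among x a b = (x ≡ a) ⊎ (x ≡ b)

pair : ℕ → ℕ → ℕ × ℕ
pair x y = x ⊓ y , x ⊔ y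

pair-ext : ∀ {a b c d} → Among a c d → Among b c d → Among c a b → Among d a b →
           pair a b ≡ pair c d
pair-ext {a} {b} {c} {d} ha hb hc hd =
  cong₂ _,_ (≤-antisym (⊓-glb (min≤ hc) (min≤ hd)) (⊓-glb (min≤ ha) (min≤ hb)))
            (≤-antisym (⊔-lub (≤max ha) (≤max hb)) (⊔-lub (≤max hc) (≤max hd)))
  where
    min≤ : ∀ {x y z} → Among x y z → y ⊓ z ≤ x
    min≤ {y = y} {z} (inj₁ refl) = m⊓n≤m y z
    min≤ {y = y} {z} (inj₂ refl) = m⊓n≤n y z
    ≤max : ∀ {x y z} → Among x y z → x ≤ y ⊔ z
    ≤max {y = y} {z} (inj₁ refl) = m≤m⊔n y z
    ≤max {y = y} {z} (inj₂ refl) = m≤n⊔m y z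

-- A cyclic word of length n = suc N: positions 0..N, position N followed by 0.
module CyclicWord (N : ℕ) (word : ℕ → ℕ) where

  before : ℕ → ℕ
  before zero    = word N
  before (suc i) = word i

  view : ℕ → ℕ × ℕ
  view i = pair (before i) (word (suc i))

  before-next : ∀ i → i < suc N → before (suc i % suc N) ≡ word i
  before-next i i<n with m≤n⇒m<n∨m≡n i<n
  ... | inj₁ si<n = cong before (m<n⇒m%n≡m si<n)
  ... | inj₂ refl = cong before (n%n≡0 (suc N))

  predecessor : ∀ i → i < suc N → ∃ λ j → j < suc N × i ≡ suc j % suc N × before i ≡ word j
  predecessor zero    _   = N , ≤-refl , sym (n%n≡0 (suc N)) , refl
  predecessor (suc j) i<n = j , <-trans (n<1+n j) i<n , sym (m<n⇒m%n≡m i<n) , refl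

  module Locating {m : ℕ}
    (wraps    : word (suc N) ≡ word 0)
    (proper   : ∀ i → i < suc N → word (suc i) ≢ word i)
    (bounded  : ∀ i → i < suc N → word i < m)
    (onto     : ∀ c → c < m → ∃ λ i → i < suc N × word i ≡ c)
    (locating : ∀ i j → i < suc N → j < suc N → word i ≡ word j → view i ≡ view j → i ≡ j)
    where

    Adj : Fin (suc N) → Fin (suc N) → Set
    Adj = CycleAdj (suc N)

    word-next : ∀ i → i < suc N → word (suc i % suc N) ≡ word (suc i)
    word-next i i<n with m≤n⇒m<n∨m≡n i<n
    ... | inj₁ si<n = cong word (m<n⇒m%n≡m si<n)
    ... | inj₂ refl = trans (cong word (n%n≡0 (suc N))) (sym wraps)

    colouring : Fin (suc N) → Fin m
    colouring u = fromℕ< (bounded (toℕ u) (toℕ<n u))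

    toℕ-colouring : ∀ u → toℕ (colouring u) ≡ word (toℕ u)
    toℕ-colouring u = toℕ-fromℕ< (bounded (toℕ u) (toℕ<n u))

    same-letter : ∀ {u v} → colouring u ≡ colouring v → word (toℕ u) ≡ word (toℕ v)
    same-letter {u} {v} e = trans (sym (toℕ-colouring u)) (trans (cong toℕ e) (toℕ-colouring v))

    neighbour-letter : ∀ u w → Adj u w → Among (word (toℕ w)) (before (toℕ u)) (word (suc (toℕ u)))
    neighbour-letter u w (inj₁ e) = inj₂ (trans (cong word e) (word-next (toℕ u) (toℕ<n u)))
    neighbour-letter u w (inj₂ e) = inj₁ (sym (trans (cong before e) (before-next (toℕ w) (toℕ<n w))))

    next-neighbour : ∀ u → ∃ λ w → Adj u w × word (toℕ w) ≡ word (suc (toℕ u))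
    next-neighbour u = fromℕ< lt , inj₁ e , trans (cong word e) (word-next (toℕ u) (toℕ<n u))
      where
        lt : suc (toℕ u) % suc N < suc N
        lt = m%n<n (suc (toℕ u)) (suc N)
        e : toℕ (fromℕ< lt) ≡ suc (toℕ u) % suc N
        e = toℕ-fromℕ< lt

    prev-neighbour : ∀ u → ∃ λ w → Adj u w × word (toℕ w) ≡ before (toℕ u)
    prev-neighbour u with predecessor (toℕ u) (toℕ<n u)
    ... | j , j<n , e , b = fromℕ< j<n , inj₂ adj , trans (cong word (toℕ-fromℕ< j<n)) (sym b)
      where
        adj : toℕ u ≡ suc (toℕ (fromℕ< j<n)) % suc N
        adj = trans e (cong (λ x → suc x % suc N) (sym (toℕ-fromℕ< j<n)))

    same-view : ∀ u v → SameNbrColors Adj colouring u v → view (toℕ u) ≡ view (toℕ v)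
    same-view u v same = pair-ext (among-of u v same (prev-neighbour u)) (among-of u v same (next-neighbour u))
                                  (among-of v u flipped (prev-neighbour v)) (among-of v u flipped (next-neighbour v))
      where
        flipped : SameNbrColors Adj colouring v u
        flipped j = proj₂ (same j) , proj₁ (same j)
        among-of : ∀ u v {x} → SameNbrColors Adj colouring u v → ∃ (λ w → Adj u w × word (toℕ w) ≡ x) →
                   Among x (before (toℕ v)) (word (suc (toℕ v)))
        among-of u v same (w , aw , refl) with proj₁ (same (colouring w)) (w , aw , refl)
        ... | w' , aw' , e with neighbour-letter v w' aw'
        ...   | inj₁ c = inj₁ (trans (sym (same-letter {w'} {w} e)) c)
        ...   | inj₂ c = inj₂ (trans (sym (same-letter {w'} {w} e)) c)

    colouring-proper : ∀ u w → Adj u w → ¬ (colouring u ≡ colouring w)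
    colouring-proper u w (inj₁ e) ce =
      proper (toℕ u) (toℕ<n u) (trans (sym (trans (cong word e) (word-next (toℕ u) (toℕ<n u)))) (sym (same-letter {u} {w} ce)))
    colouring-proper u w (inj₂ e) ce =
      proper (toℕ w) (toℕ<n w) (trans (sym (trans (cong word e) (word-next (toℕ w) (toℕ<n w)))) (same-letter {u} {w} ce))

    colouring-onto : ∀ y → ∃ λ u → ∀ {z} → z ≡ u → colouring z ≡ y
    colouring-onto y with onto (toℕ y) (toℕ<n y)
    ... | i , i<n , e = fromℕ< i<n , λ { refl → toℕ-injective
          (trans (toℕ-colouring (fromℕ< i<n)) (trans (cong word (toℕ-fromℕ< i<n)) e)) }

    nl-colouring : ∃ λ (c : Fin (suc N) → Fin m) → IsNLColoring Adj m c
    nl-colouring = colouring , (colouring-onto , colouring-proper) ,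
      λ u v u≢v ce same → u≢v (toℕ-injective (locating (toℕ u) (toℕ v) (toℕ<n u) (toℕ<n v)
                                               (same-letter {u} {v} ce) (same-view u v same)))

-- Which of the three colours p < q < r of the current triple is written.
data Slot : Set where
  atP atQ atR : Slot

record State : Set where
  constructor st
  field
    p q r : ℕ
    slot  : Slot

letter : State → ℕ
letter (st p q r atP) = p
letter (st p q r atQ) = q
letter (st p q r atR) = r

-- Letters still to be written in the current period p,q,r after this one.
restOfPeriod : Slot → ℕ
restOfPeriod atP = 2
restOfPeriod atQ = 1
restOfPeriod atR = 0

-- The last state of the cycle is (0,1,2) at q.
isFinal : ℕ → ℕ → ℕ → Bool
isFinal zero (suc zero) (suc (suc zero)) = true
isFinal _    _          _                = false

-- The first pair of the cycle is (0,2).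
isFirstPair : ℕ → ℕ → Bool
isFirstPair zero (suc (suc zero)) = true
isFirstPair _    _                = false

isFinal-inv : ∀ {p q r} → isFinal p q r ≡ true → p ≡ 0 × q ≡ 1 × r ≡ 2
isFinal-inv {zero} {suc zero} {suc (suc zero)} _ = refl , refl , refl
isFinal-inv {zero} {zero} ()
isFinal-inv {zero} {suc zero} {zero} ()
isFinal-inv {zero} {suc zero} {suc zero} ()
isFinal-inv {zero} {suc zero} {suc (suc (suc r))} ()
isFinal-inv {zero} {suc (suc q)} ()
isFinal-inv {suc p} ()

isFinal-false : ∀ {p q r} → q ≢ suc p → isFinal p q r ≡ false
isFinal-false {p} {q} {r} ne with isFinal p q r in eq
... | false = refl
... | true with isFinal-inv eq
...   | refl , refl , refl = ⊥-elim (ne refl)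

isFirstPair-inv : ∀ {p q} → isFirstPair p q ≡ true → p ≡ 0 × q ≡ 2
isFirstPair-inv {zero} {suc (suc zero)} _ = refl , refl
isFirstPair-inv {zero} {zero} ()
isFirstPair-inv {zero} {suc zero} ()
isFirstPair-inv {zero} {suc (suc (suc q))} ()
isFirstPair-inv {suc p} ()

triangle : ℕ → ℕ
triangle zero    = 0
triangle (suc j) = suc j + triangle j

triangle-double : ∀ j → 2 * triangle j ≡ j * suc j
triangle-double zero    = refl
triangle-double (suc j) = begin
  2 * (suc j + triangle j)     ≡⟨ *-distribˡ-+ 2 (suc j) (triangle j) ⟩
  2 * suc j + 2 * triangle j   ≡⟨ cong (2 * suc j +_) (triangle-double j) ⟩
  2 * suc j + j * suc j        ≡⟨ solve (j ∷ []) ⟩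
  suc j * suc (suc j)          ∎
  where open ≡-Reasoning

-- Letters contributed by the rows p' = p+1, …, k−2 when j = k − p − 2 of them
-- remain: row p' consists of the pair (p',p'+1) (2(k−p'−1) letters) and the
-- pairs (p',q') with q' > p'+1 (3(k−q') letters each).
rows : ℕ → ℕ
rows zero    = 0
rows (suc j) = rows j + 2 * suc j + 3 * triangle j

rows-double : ∀ j → 2 * rows (suc j) ≡ 2 * suc j * suc (suc j) + suc (suc j) * suc j * j
rows-double zero    = refl
rows-double (suc j) = begin
  2 * (rows (suc j) + 2 * suc (suc j) + 3 * triangle (suc j))
    ≡⟨ distribute (rows (suc j)) j (triangle (suc j)) ⟩
  2 * rows (suc j) + 4 * suc (suc j) + 3 * (2 * triangle (suc j))
    ≡⟨ cong₂ (λ x y → x + 4 * suc (suc j) + 3 * y) (rows-double j) (triangle-double (suc j)) ⟩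
  2 * suc j * suc (suc j) + suc (suc j) * suc j * j + 4 * suc (suc j) + 3 * (suc j * suc (suc j))
    ≡⟨ solve (j ∷ []) ⟩
  2 * suc (suc j) * suc (suc (suc j)) + suc (suc (suc j)) * suc (suc j) * suc j ∎
  where
    open ≡-Reasoning
    distribute : ∀ B j T → 2 * (B + 2 * suc (suc j) + 3 * T) ≡ 2 * B + 4 * suc (suc j) + 3 * (2 * T)
    distribute = solve-∀

-- The cycle is read as a sequence of states (p, q, r, slot), p < q < r ≤ k;
-- for each pair p < q it writes the periods  p q r  for r = k, k−1, …, q+1,
-- omitting p when q = p+1.  Pairs come in lexicographic order starting at
-- (0,2); the pair (0,1) comes last and its final period is cut after the 1,
-- after which the cycle closes at (0,2,k).
module Construction (K : ℕ) where

  k : ℕ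
  k = 4 + K

  start final : State
  start = st 0 2 k atP
  final = st 0 1 2 atQ

  -- The slot at which a period is resumed after lowering r: q if p is omitted.
  resumeSlot : ℕ → ℕ → Slot
  resumeSlot p q with q ≟ suc p
  ... | yes _ = atQ
  ... | no  _ = atP

  resumeSlot-omit : ∀ {p q} → q ≡ suc p → resumeSlot p q ≡ atQ
  resumeSlot-omit {p} {q} e with q ≟ suc p
  ... | yes _ = refl
  ... | no ne = ⊥-elim (ne e)

  resumeSlot-full : ∀ {p q} → q ≢ suc p → resumeSlot p q ≡ atP
  resumeSlot-full {p} {q} ne with q ≟ suc p
  ... | yes e = ⊥-elim (ne e)
  ... | no  _ = refl

  period : ℕ → ℕ → ℕ
  period p q = suc (restOfPeriod (resumeSlot p q))

  period-omit : ∀ p → period p (suc p) ≡ 2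
  period-omit p = cong (suc ∘ restOfPeriod) (resumeSlot-omit {p} refl)

  period-full : ∀ {p q} → q ≢ suc p → period p q ≡ 3
  period-full ne = cong (suc ∘ restOfPeriod) (resumeSlot-full ne)

  afterQ : ℕ → ℕ → ℕ → State
  afterQ p q r = if isFinal p q r then start else st p q r atR

  afterR : ℕ → ℕ → ℕ → State
  afterR p q r with suc q <? r
  ... | yes _ = st p q (pred r) (resumeSlot p q)
  ... | no  _ with suc q <? k
  ...   | yes _ = st p (suc q) k atP
  ...   | no  _ with suc (suc (suc p)) ≤? k
  ...     | yes _ = st (suc p) (suc (suc p)) k atQ
  ...     | no  _ = st 0 1 k atQ

  step : State → State
  step (st p q r atP) = st p q r atQ
  step (st p q r atQ) = afterQ p q r
  step (st p q r atR) = afterR p q r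

  record Valid (s : State) : Set where
    field
      p<q       : State.p s < State.q s
      q<r       : State.q s < State.r s
      r≤k       : State.r s ≤ k
      omitP     : State.q s ≡ suc (State.p s) → State.slot s ≢ atP
      cutFinal  : State.p s ≡ 0 → State.q s ≡ 1 → State.r s ≡ 2 → State.slot s ≢ atR
  open Valid

  start-valid : Valid start
  start-valid = record { p<q = s≤s z≤n ; q<r = s≤s (s≤s (s≤s z≤n)) ; r≤k = ≤-refl
                       ; omitP = λ () ; cutFinal = λ _ () }

  r≡1+q : ∀ {q r} → q < r → ¬ (suc q < r) → r ≡ suc q
  r≡1+q q<r ¬1+q<r = ≤-antisym (≮⇒≥ ¬1+q<r) q<r

  afterR-valid : ∀ p q r → Valid (st p q r atR) → Valid (afterR p q r)
  afterR-valid p q r v with suc q <? r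
  ... | yes 1+q<r = record { p<q = p<q v ; q<r = suc[m]≤n⇒m≤pred[n] 1+q<r ; r≤k = ≤-trans pred[n]≤n (r≤k v)
                           ; omitP = λ e → subst (_≢ atP) (sym (resumeSlot-omit e)) (λ ())
                           ; cutFinal = λ _ _ _ → resumeSlot-not-atR }
    where
      resumeSlot-not-atR : resumeSlot p q ≢ atR
      resumeSlot-not-atR with q ≟ suc p
      ... | yes _ = λ ()
      ... | no  _ = λ ()
  ... | no _ with suc q <? k
  ...   | yes 1+q<k = record { p<q = m≤n⇒m≤1+n (p<q v) ; q<r = 1+q<k ; r≤k = ≤-refl
                             ; omitP = λ e _ → <⇒≢ (p<q v) (sym (suc-injective e)) ; cutFinal = λ _ _ _ () }
  ...   | no _ with suc (suc (suc p)) ≤? k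
  ...     | yes 3+p≤k = record { p<q = n<1+n (suc p) ; q<r = 3+p≤k ; r≤k = ≤-refl
                               ; omitP = λ _ () ; cutFinal = λ _ () }
  ...     | no _ = record { p<q = s≤s z≤n ; q<r = s≤s (s≤s z≤n) ; r≤k = ≤-refl
                          ; omitP = λ _ () ; cutFinal = λ _ _ () }

  step-valid : ∀ s → Valid s → Valid (step s)
  step-valid (st p q r atP) v = record { p<q = p<q v ; q<r = q<r v ; r≤k = r≤k v
                                       ; omitP = λ _ () ; cutFinal = λ _ _ _ () }
  step-valid (st p q r atQ) v with isFinal p q r in eq
  ... | true  = start-valid
  ... | false = record { p<q = p<q v ; q<r = q<r v ; r≤k = r≤k v ; omitP = λ _ () ; cutFinal = notFinal }
    where
      notFinal : p ≡ 0 → q ≡ 1 → r ≡ 2 → atR ≢ atR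
      notFinal refl refl refl _ = contradiction eq λ ()
  step-valid (st p q r atR) v = afterR-valid p q r v

  -- The last letter k of row k−2 followed by the 2k−3 letters 1 k 1 … 3 1 of
  -- the final pair (0,1).
  finalBlock : ℕ
  finalBlock = 6 + K + K

  -- Letters from the r of the current period of (p,q) to the end of the
  -- cycle: the remaining periods of (p,q), the pairs (p,q') with q' > q, the
  -- later rows, and the final block.
  lettersFrom′ : ℕ → ℕ → ℕ → ℕ
  lettersFrom′ p q r =
    finalBlock + (r ∸ suc q) * period p q + 3 * triangle (k ∸ suc q) + rows (k ∸ suc (suc p))

  lettersFrom : ℕ → ℕ → ℕ → ℕ
  lettersFrom zero (suc zero) r = (r ∸ 2) * 2
  lettersFrom p    q          r = lettersFrom′ p q r

  remaining : State → ℕ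
  remaining (st p q r t) = restOfPeriod t + lettersFrom p q r

  lettersFrom-generic : ∀ p q r → ¬ (p ≡ 0 × q ≡ 1) → lettersFrom p q r ≡ lettersFrom′ p q r
  lettersFrom-generic zero    zero             r _ = refl
  lettersFrom-generic zero    (suc zero)       r h = ⊥-elim (h (refl , refl))
  lettersFrom-generic zero    (suc (suc q))    r _ = refl
  lettersFrom-generic (suc p) q                r _ = refl

  ∸-unfold : ∀ {m n} → m < n → n ∸ m ≡ suc (n ∸ suc m)
  ∸-unfold m<n = +-∸-assoc 1 m<n

  remaining-lower′ : ∀ p q r → suc q < r → ¬ (p ≡ 0 × q ≡ 1) →
    suc (restOfPeriod (resumeSlot p q) + lettersFrom p q (pred r)) ≡ lettersFrom p q r
  remaining-lower′ p q (suc r) (s≤s q<r) not01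
    rewrite lettersFrom-generic p q r not01 | lettersFrom-generic p q (suc r) not01 | ∸-unfold q<r
    = one-more-period (restOfPeriod (resumeSlot p q)) finalBlock (r ∸ suc q)
                      (3 * triangle (k ∸ suc q)) (rows (k ∸ suc (suc p)))
    where
      one-more-period : ∀ L D a X Y → suc (L + (D + a * suc L + X + Y)) ≡ D + suc a * suc L + X + Y
      one-more-period = solve-∀

  -- In the final pair (0,1) every period has the two letters 1 r.
  remaining-lower : ∀ p q r → suc q < r →
    suc (restOfPeriod (resumeSlot p q) + lettersFrom p q (pred r)) ≡ lettersFrom p q r
  remaining-lower zero    (suc zero)    (suc (suc (suc r))) _ = refl
  remaining-lower zero    (suc zero)    (suc (suc zero)) (s≤s (s≤s ()))
  remaining-lower zero    (suc zero)    (suc zero) (s≤s ())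
  remaining-lower zero    zero          r 1+q<r = remaining-lower′ zero zero r 1+q<r (λ ())
  remaining-lower zero    (suc (suc q)) r 1+q<r = remaining-lower′ zero (suc (suc q)) r 1+q<r (λ ())
  remaining-lower (suc p) q             r 1+q<r = remaining-lower′ (suc p) q r 1+q<r (λ ())

  remaining-nextPair : ∀ p q → Valid (st p q (suc q) atR) → suc q < k →
    suc (2 + lettersFrom p (suc q) k) ≡ lettersFrom p q (suc q)
  remaining-nextPair p q v 1+q<k
    rewrite lettersFrom-generic p (suc q) k (λ (_ , e) → n≮0 (subst (p <_) (suc-injective e) (p<q v)))
          | lettersFrom-generic p q (suc q) (λ (e₁ , e₂) → cutFinal v e₁ e₂ (cong suc e₂) refl)
          | n∸n≡0 q | ∸-unfold 1+q<k
          | period-full {p} {suc q} (λ e → <⇒≢ (p<q v) (sym (suc-injective e)))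
    = next-pair finalBlock (k ∸ suc (suc q)) (triangle (k ∸ suc (suc q))) (rows (k ∸ suc (suc p)))
    where
      next-pair : ∀ D j T B → suc (2 + (D + j * 3 + 3 * T + B)) ≡ D + 0 + 3 * (suc j + T) + B
      next-pair = solve-∀

  remaining-nextRow : ∀ p → suc (suc (suc p)) ≤ k →
    suc (1 + lettersFrom (suc p) (suc (suc p)) k) ≡ lettersFrom p (3 + K) k
  remaining-nextRow p 3+p≤k
    rewrite lettersFrom-generic p (3 + K) k (λ ()) | n∸n≡0 K | period-omit (suc p) | ∸-unfold 3+p≤k
    = next-row finalBlock (k ∸ suc (suc (suc p))) (triangle (k ∸ suc (suc (suc p)))) (rows (k ∸ suc (suc (suc p))))
    where
      next-row : ∀ D j T B → suc (1 + (D + j * 2 + 3 * T + B)) ≡ D + 0 + 3 * 0 + (B + 2 * suc j + 3 * T)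
      next-row = solve-∀

  remaining-toFinal : suc (1 + lettersFrom 0 1 k) ≡ lettersFrom (2 + K) (3 + K) k
  remaining-toFinal rewrite n∸n≡0 K = to-final K
    where
      to-final : ∀ K → suc (1 + suc (suc K) * 2) ≡ 6 + K + K + 0 + 3 * 0 + 0
      to-final = solve-∀

  lastRow : ∀ {p} → p < 3 + K → ¬ (suc (suc (suc p)) ≤ k) → p ≡ 2 + K
  lastRow p<q ¬3+p≤k = ≤-antisym (s≤s⁻¹ p<q) (s≤s⁻¹ (s≤s⁻¹ (s≤s⁻¹ (≰⇒> ¬3+p≤k))))

  remaining-afterR : ∀ p q r → Valid (st p q r atR) → suc (remaining (afterR p q r)) ≡ lettersFrom p q r
  remaining-afterR p q r v with suc q <? r
  ... | yes 1+q<r = remaining-lower p q r 1+q<r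
  ... | no ¬1+q<r with r≡1+q (q<r v) ¬1+q<r
  ...   | refl with suc q <? k
  ...     | yes 1+q<k = remaining-nextPair p q v 1+q<k
  ...     | no ¬1+q<k with ≤-antisym (r≤k v) (≮⇒≥ ¬1+q<k)
  ...       | refl with suc (suc (suc p)) ≤? k
  ...         | yes 3+p≤k = remaining-nextRow p 3+p≤k
  ...         | no ¬3+p≤k with lastRow (p<q v) ¬3+p≤k
  ...           | refl = remaining-toFinal

  remaining-step : ∀ s → Valid s → 2 ≤ remaining s → suc (remaining (step s)) ≡ remaining s
  remaining-step (st p q r atP) v _ = refl
  remaining-step (st p q r atQ) v 2≤ with isFinal p q r in eq
  ... | false = refl
  ... | true with isFinal-inv eq
  ...   | refl , refl , refl = ⊥-elim (<-irrefl refl 2≤)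
  remaining-step (st p q r atR) v _ = remaining-afterR p q r v

  -- Away from the pair (0,1) at least the final block remains.
  remaining-generic-≢1 : ∀ t p q r → restOfPeriod t + lettersFrom′ p q r ≢ 1
  remaining-generic-≢1 t p q r e =
    <-irrefl (sym e) (≤-trans (s≤s (s≤s z≤n)) (m≤n+m (lettersFrom′ p q r) (restOfPeriod t)))

  remaining-final : ∀ s → Valid s → remaining s ≡ 1 → s ≡ final
  remaining-final (st zero (suc zero) r atP) v _ = ⊥-elim (omitP v refl refl)
  remaining-final (st zero (suc zero) (suc (suc zero)) atQ) v _ = refl
  remaining-final (st zero (suc zero) (suc (suc (suc r))) atQ) v ()
  remaining-final (st zero (suc zero) (suc (suc zero)) atR) v _ = ⊥-elim (cutFinal v refl refl refl refl)
  remaining-final (st zero (suc zero) (suc (suc (suc r))) atR) v ()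
  remaining-final (st zero (suc zero) zero t) v _ = ⊥-elim (n≮0 (q<r v))
  remaining-final (st zero (suc zero) (suc zero) t) v _ = ⊥-elim (<-irrefl refl (q<r v))
  remaining-final (st zero zero r t) v e = ⊥-elim (remaining-generic-≢1 t zero zero r e)
  remaining-final (st zero (suc (suc q)) r t) v e = ⊥-elim (remaining-generic-≢1 t zero (suc (suc q)) r e)
  remaining-final (st (suc p) q r t) v e = ⊥-elim (remaining-generic-≢1 t (suc p) q r e)

  -- The letter written just before a state at p: the r+1 of the previous
  -- period, or the end q of the pair (p,q−1) (the 1 of the final state for (0,2)).
  beforeP : ℕ → ℕ → ℕ → ℕ
  beforeP p q r with r <? k
  ... | yes _ = suc r
  ... | no  _ = if isFirstPair p q then 1 else q

  -- The letter written just before a state at q: p, or when p is omitted the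
  -- r+1 of the previous period (k at the start of the pair).
  beforeQ : ℕ → ℕ → ℕ → ℕ
  beforeQ p q r with q ≟ suc p
  ... | no  _ = p
  ... | yes _ with r <? k
  ...   | yes _ = suc r
  ...   | no  _ = k

  prevLetter : State → ℕ
  prevLetter (st p q r atP) = beforeP p q r
  prevLetter (st p q r atQ) = beforeQ p q r
  prevLetter (st p q r atR) = q

  nextLetter : State → ℕ
  nextLetter s = letter (step s)

  beforeP-inner : ∀ {p q r} → r < k → beforeP p q r ≡ suc r
  beforeP-inner {p} {q} {r} r<k with r <? k
  ... | yes _   = refl
  ... | no  r≮k = ⊥-elim (r≮k r<k)

  beforeP-start : ∀ {p q} → beforeP p q k ≡ (if isFirstPair p q then 1 else q)
  beforeP-start with k <? k
  ... | yes k<k = ⊥-elim (<-irrefl refl k<k)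
  ... | no  _   = refl

  beforeQ-full : ∀ {p q r} → q ≢ suc p → beforeQ p q r ≡ p
  beforeQ-full {p} {q} {r} ne with q ≟ suc p
  ... | yes e = ⊥-elim (ne e)
  ... | no  _ = refl

  beforeQ-inner : ∀ {p q r} → q ≡ suc p → r < k → beforeQ p q r ≡ suc r
  beforeQ-inner {p} {q} {r} e r<k with q ≟ suc p
  ... | no ne = ⊥-elim (ne e)
  ... | yes _ with r <? k
  ...   | yes _   = refl
  ...   | no  r≮k = ⊥-elim (r≮k r<k)

  beforeQ-start : ∀ {p q} → q ≡ suc p → beforeQ p q k ≡ k
  beforeQ-start {p} {q} e with q ≟ suc p
  ... | no ne = ⊥-elim (ne e)
  ... | yes _ with k <? k
  ...   | yes k<k = ⊥-elim (<-irrefl refl k<k)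
  ...   | no  _   = refl

  prevLetter-afterR : ∀ p q r → Valid (st p q r atR) → prevLetter (afterR p q r) ≡ r
  prevLetter-afterR p q zero v = ⊥-elim (n≮0 (q<r v))
  prevLetter-afterR p q (suc r) v with suc q <? suc r
  ... | yes _ with q ≟ suc p
  ...   | yes e = beforeQ-inner e (r≤k v)
  ...   | no  _ = beforeP-inner (r≤k v)
  prevLetter-afterR p q (suc r) v | no ¬1+q<r with r≡1+q (q<r v) ¬1+q<r
  ...   | refl with suc q <? k
  ...     | yes _ = first-not-cut
    where
      first-not-cut : beforeP p (suc q) k ≡ suc q
      first-not-cut rewrite beforeP-start {p} {suc q} with isFirstPair p (suc q) in eq
      ... | false = refl
      ... | true with isFirstPair-inv eq
      ...   | refl , refl = ⊥-elim (cutFinal v refl refl refl refl)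
  ...     | no ¬1+q<k with ≤-antisym (r≤k v) (≮⇒≥ ¬1+q<k)
  ...       | refl with suc (suc (suc p)) ≤? k
  ...         | yes _ = beforeQ-start {suc p} refl
  ...         | no  _ = beforeQ-start {0} refl

  prev-step : ∀ s → Valid s → prevLetter (step s) ≡ letter s
  prev-step (st p q r atP) v = beforeQ-full (λ e → omitP v e refl)
  prev-step (st p q r atQ) v with isFinal p q r in eq
  ... | true with isFinal-inv eq
  ...   | refl , refl , refl = beforeP-start
  prev-step (st p q r atQ) v | false = refl
  prev-step (st p q r atR) v = prevLetter-afterR p q r v

  -- The letter after r is q, p, p+2 or 1, all different from r.
  afterR-differs : ∀ p q r → Valid (st p q r atR) → letter (afterR p q r) ≢ r
  afterR-differs p q r v with suc q <? r
  ... | yes _ with q ≟ suc p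
  ...   | yes _ = <⇒≢ (q<r v)
  ...   | no  _ = <⇒≢ (<-trans (p<q v) (q<r v))
  afterR-differs p q r v | no ¬1+q<r with r≡1+q (q<r v) ¬1+q<r
  ...   | refl with suc q <? k
  ...     | yes _ = <⇒≢ (<-trans (p<q v) (q<r v))
  ...     | no ¬1+q<k with ≤-antisym (r≤k v) (≮⇒≥ ¬1+q<k)
  ...       | refl with suc (suc (suc p)) ≤? k
  ...         | yes 3+p≤k = <⇒≢ 3+p≤k
  ...         | no  _     = λ ()

  next-differs : ∀ s → Valid s → nextLetter s ≢ letter s
  next-differs (st p q r atP) v = >⇒≢ (p<q v)
  next-differs (st p q r atQ) v with isFinal p q r in eq
  ... | true with isFinal-inv eq
  ...   | refl , refl , refl = λ ()
  next-differs (st p q r atQ) v | false = >⇒≢ (q<r v)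
  next-differs (st p q r atR) v = afterR-differs p q r v

  letter-≤k : ∀ s → Valid s → letter s ≤ k
  letter-≤k (st p q r atP) v = <⇒≤ (<-≤-trans (<-trans (p<q v) (q<r v)) (r≤k v))
  letter-≤k (st p q r atQ) v = <⇒≤ (<-≤-trans (q<r v) (r≤k v))
  letter-≤k (st p q r atR) v = r≤k v

  -- Equal neighbours occur at p when r = k is
  -- repeated, and at r when the neighbours are both q (p omitted) or the
  -- corner k−1 ↦ k ↦ k−1 between rows; lo < x < hi happens exactly at q;
  -- x above both neighbours means x = r; x below lo means x = p.
  decode : ℕ → ℕ × ℕ → State
  decode x (lo , hi) =
    if does (lo ≟ hi) then
      (if does (x <? lo)
         then (if does (lo ≟ k) then st (pred x) x k atQ else st x lo k atP)
         else (if does ((x ≟ k) ×-dec (lo ≟ k ∸ 1)) then st (k ∸ 3) (k ∸ 1) k atR else st (pred lo) lo x atR))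
    else if does (lo <? x) then
      (if does (x <? hi)
         then (if does ((x ≟ 1) ×-dec (lo ≟ 0) ×-dec (hi ≟ 3)) then final else st lo x hi atQ)
         else (if does ((x ≟ k) ×-dec (hi ≟ k ∸ 1))
                 then (if does (lo ≟ 1) then st (k ∸ 2) (k ∸ 1) k atR else st (lo ∸ 2) (k ∸ 1) k atR)
                 else st lo hi x atR))
    else (if does (hi ≟ suc lo)
            then (if does (x ≟ 0) then start else st (pred x) x lo atQ)
            else st x lo (pred hi) atP)

  decode-equal-below-k : ∀ {x lo hi} → lo ≡ hi → x < lo → lo ≡ k → decode x (lo , hi) ≡ st (pred x) x k atQ
  decode-equal-below-k {x} {lo} {hi} a b c
    rewrite dec-true (lo ≟ hi) a | dec-true (x <? lo) b | dec-true (lo ≟ k) c = refl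

  decode-equal-below : ∀ {x lo hi} → lo ≡ hi → x < lo → lo ≢ k → decode x (lo , hi) ≡ st x lo k atP
  decode-equal-below {x} {lo} {hi} a b c
    rewrite dec-true (lo ≟ hi) a | dec-true (x <? lo) b | dec-false (lo ≟ k) c = refl

  decode-equal-corner : ∀ {x lo hi} → lo ≡ hi → ¬ x < lo → x ≡ k → lo ≡ k ∸ 1 →
                        decode x (lo , hi) ≡ st (k ∸ 3) (k ∸ 1) k atR
  decode-equal-corner {x} {lo} {hi} a b c d
    rewrite dec-true (lo ≟ hi) a | dec-false (x <? lo) b | dec-true ((x ≟ k) ×-dec (lo ≟ k ∸ 1)) (c , d) = refl

  decode-equal-above : ∀ {x lo hi} → lo ≡ hi → ¬ x < lo → ¬ (x ≡ k × lo ≡ k ∸ 1) →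
                       decode x (lo , hi) ≡ st (pred lo) lo x atR
  decode-equal-above {x} {lo} {hi} a b c
    rewrite dec-true (lo ≟ hi) a | dec-false (x <? lo) b | dec-false ((x ≟ k) ×-dec (lo ≟ k ∸ 1)) c = refl

  decode-between-final : ∀ {x lo hi} → lo ≢ hi → lo < x → x < hi → x ≡ 1 → lo ≡ 0 → hi ≡ 3 →
                         decode x (lo , hi) ≡ final
  decode-between-final {x} {lo} {hi} a b c d e f
    rewrite dec-false (lo ≟ hi) a | dec-true (lo <? x) b | dec-true (x <? hi) c
          | dec-true ((x ≟ 1) ×-dec (lo ≟ 0) ×-dec (hi ≟ 3)) (d , e , f) = refl

  decode-between : ∀ {x lo hi} → lo ≢ hi → lo < x → x < hi → x ≢ 1 → decode x (lo , hi) ≡ st lo x hi atQ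
  decode-between {x} {lo} {hi} a b c d
    rewrite dec-false (lo ≟ hi) a | dec-true (lo <? x) b | dec-true (x <? hi) c
          | dec-false ((x ≟ 1) ×-dec (lo ≟ 0) ×-dec (hi ≟ 3)) (d ∘ proj₁) = refl

  decode-above-lastRow : ∀ {x lo hi} → lo ≢ hi → lo < x → ¬ x < hi → x ≡ k → hi ≡ k ∸ 1 → lo ≡ 1 →
                         decode x (lo , hi) ≡ st (k ∸ 2) (k ∸ 1) k atR
  decode-above-lastRow {x} {lo} {hi} a b c d e f
    rewrite dec-false (lo ≟ hi) a | dec-true (lo <? x) b | dec-false (x <? hi) c
          | dec-true ((x ≟ k) ×-dec (hi ≟ k ∸ 1)) (d , e) | dec-true (lo ≟ 1) f = refl

  decode-above-rowEnd : ∀ {x lo hi} → lo ≢ hi → lo < x → ¬ x < hi → x ≡ k → hi ≡ k ∸ 1 → lo ≢ 1 →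
                        decode x (lo , hi) ≡ st (lo ∸ 2) (k ∸ 1) k atR
  decode-above-rowEnd {x} {lo} {hi} a b c d e f
    rewrite dec-false (lo ≟ hi) a | dec-true (lo <? x) b | dec-false (x <? hi) c
          | dec-true ((x ≟ k) ×-dec (hi ≟ k ∸ 1)) (d , e) | dec-false (lo ≟ 1) f = refl

  decode-above : ∀ {x lo hi} → lo ≢ hi → lo < x → ¬ x < hi → ¬ (x ≡ k × hi ≡ k ∸ 1) →
                 decode x (lo , hi) ≡ st lo hi x atR
  decode-above {x} {lo} {hi} a b c d
    rewrite dec-false (lo ≟ hi) a | dec-true (lo <? x) b | dec-false (x <? hi) c
          | dec-false ((x ≟ k) ×-dec (hi ≟ k ∸ 1)) d = refl

  decode-below-start : ∀ {x lo hi} → lo ≢ hi → ¬ lo < x → hi ≡ suc lo → x ≡ 0 → decode x (lo , hi) ≡ start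
  decode-below-start {x} {lo} {hi} a b c d
    rewrite dec-false (lo ≟ hi) a | dec-false (lo <? x) b | dec-true (hi ≟ suc lo) c | dec-true (x ≟ 0) d = refl

  decode-below-omit : ∀ {x lo hi} → lo ≢ hi → ¬ lo < x → hi ≡ suc lo → x ≢ 0 →
                      decode x (lo , hi) ≡ st (pred x) x lo atQ
  decode-below-omit {x} {lo} {hi} a b c d
    rewrite dec-false (lo ≟ hi) a | dec-false (lo <? x) b | dec-true (hi ≟ suc lo) c | dec-false (x ≟ 0) d = refl

  decode-below : ∀ {x lo hi} → lo ≢ hi → ¬ lo < x → hi ≢ suc lo → decode x (lo , hi) ≡ st x lo (pred hi) atP
  decode-below {x} {lo} {hi} a b c
    rewrite dec-false (lo ≟ hi) a | dec-false (lo <? x) b | dec-false (hi ≟ suc lo) c = refl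

  decode-atP : ∀ p q r → Valid (st p q r atP) → decode p (pair (beforeP p q r) q) ≡ st p q r atP
  decode-atP p q r v with m≤n⇒m<n∨m≡n (r≤k v)
  ... | inj₁ r<k rewrite beforeP-inner {p} {q} r<k
                       | m≥n⇒m⊓n≡n (m≤n⇒m≤1+n (<⇒≤ (q<r v))) | m≥n⇒m⊔n≡m (m≤n⇒m≤1+n (<⇒≤ (q<r v)))
    = decode-below (<⇒≢ (m≤n⇒m≤1+n (q<r v))) (<-asym (p<q v)) (λ e → <⇒≢ (q<r v) (sym (suc-injective e)))
  ... | inj₂ refl rewrite beforeP-start {p} {q} with isFirstPair p q in eq
  ...   | false rewrite ⊓-idem q | ⊔-idem q = decode-equal-below refl (p<q v) (<⇒≢ (q<r v))
  ...   | true with isFirstPair-inv eq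
  ...     | refl , refl = decode-below-start {0} {1} {2} (λ ()) (λ ()) refl refl

  decode-atQ : ∀ p q r → Valid (st p q r atQ) →
               decode q (pair (beforeQ p q r) (letter (afterQ p q r))) ≡ st p q r atQ
  decode-atQ p q r v with toSum (q ≟ suc p)
  ... | inj₂ q≢1+p rewrite isFinal-false {p} {q} {r} q≢1+p | beforeQ-full {p} {q} {r} q≢1+p
                       | m≤n⇒m⊓n≡m (<⇒≤ (<-trans (p<q v) (q<r v))) | m≤n⇒m⊔n≡n (<⇒≤ (<-trans (p<q v) (q<r v)))
    = decode-between (<⇒≢ (<-trans (p<q v) (q<r v))) (p<q v) (q<r v)
                     (λ q≡1 → q≢1+p (trans q≡1 (cong suc (sym (n<1⇒n≡0 (subst (p <_) q≡1 (p<q v)))))))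
  ... | inj₁ refl with isFinal p (suc p) r in eq
  ...   | true with isFinal-inv eq
  ...     | refl , refl , refl = decode-between-final (λ ()) (s≤s z≤n) (s≤s (s≤s z≤n)) refl refl refl
  decode-atQ p q r v | inj₁ refl | false with m≤n⇒m<n∨m≡n (r≤k v)
  ...     | inj₁ r<k rewrite beforeQ-inner {p} {suc p} {r} refl r<k
                           | m≥n⇒m⊓n≡n (n≤1+n r) | m≥n⇒m⊔n≡m (n≤1+n r)
    = decode-below-omit (λ e → <-irrefl e (n<1+n r)) (<-asym (q<r v)) refl (λ ())
  ...     | inj₂ refl rewrite beforeQ-start {p} {suc p} refl | ⊓-idem K | ⊔-idem K
    = decode-equal-below-k refl (q<r v) refl

  p≤1+K : ∀ {p} → suc (suc p) < 3 + K → p ≤ suc K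
  p≤1+K 2+p<k-1 = m≤n⇒m≤1+n (s≤s⁻¹ (s≤s⁻¹ (s≤s⁻¹ 2+p<k-1)))

  decode-atR : ∀ p q r → Valid (st p q r atR) → decode r (pair q (letter (afterR p q r))) ≡ st p q r atR
  decode-atR p q r v with suc q <? r
  ... | yes 1+q<r with toSum (q ≟ suc p)
  ...   | inj₁ refl rewrite resumeSlot-omit {p} refl | ⊓-idem p | ⊔-idem p
    = decode-equal-above refl (<-asym (q<r v)) (λ (e₁ , e₂) → <-irrefl (trans (cong suc e₂) (sym e₁)) 1+q<r)
  ...   | inj₂ q≢1+p rewrite resumeSlot-full q≢1+p | m≥n⇒m⊓n≡n (<⇒≤ (p<q v)) | m≥n⇒m⊔n≡m (<⇒≤ (p<q v))
    = decode-above (<⇒≢ (p<q v)) (<-trans (p<q v) (q<r v)) (<-asym (q<r v))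
                   (λ (e₁ , e₂) → <-irrefl (trans (cong suc e₂) (sym e₁)) 1+q<r)
  decode-atR p q r v | no ¬1+q<r with r≡1+q (q<r v) ¬1+q<r
  ...   | refl with suc q <? k
  ...     | yes 1+q<k rewrite m≥n⇒m⊓n≡n (<⇒≤ (p<q v)) | m≥n⇒m⊔n≡m (<⇒≤ (p<q v))
    = decode-above (<⇒≢ (p<q v)) (m≤n⇒m≤1+n (p<q v)) (λ e → <-irrefl refl (<-trans e (n<1+n q)))
                   (λ (e₁ , _) → <-irrefl e₁ 1+q<k)
  ...     | no ¬1+q<k with ≤-antisym (r≤k v) (≮⇒≥ ¬1+q<k)
  ...       | refl with suc (suc (suc p)) ≤? k
  ...         | no ¬3+p≤k with lastRow (p<q v) ¬3+p≤k
  ...           | refl = decode-above-lastRow (λ ()) (s≤s (s≤s z≤n)) (λ e → <-irrefl refl (<-trans e (n<1+n _))) refl refl refl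
  decode-atR p q r v | no _ | refl | no _ | refl | yes 3+p≤k with m≤n⇒m<n∨m≡n (s≤s⁻¹ 3+p≤k)
  ...   | inj₂ refl rewrite ⊓-idem K | ⊔-idem K
    = decode-equal-corner refl (λ e → <-irrefl refl (<-trans e (n<1+n _))) refl refl
  ...   | inj₁ 2+p<k-1 rewrite m≥n⇒m⊓n≡n (p≤1+K 2+p<k-1) | m≥n⇒m⊔n≡m (p≤1+K 2+p<k-1)
    = decode-above-rowEnd (<⇒≢ 2+p<k-1) (<-trans 2+p<k-1 (n<1+n _)) (λ e → <-irrefl refl (<-trans e (n<1+n _)))
                          refl refl (λ ())

  decode-view : ∀ s → Valid s → decode (letter s) (pair (prevLetter s) (nextLetter s)) ≡ s
  decode-view (st p q r atP) v = decode-atP p q r v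
  decode-view (st p q r atQ) v = decode-atQ p q r v
  decode-view (st p q r atR) v = decode-atR p q r v

  walk : ℕ → State
  walk zero    = start
  walk (suc i) = step (walk i)

  n N : ℕ
  n = remaining start
  N = pred n

  walk-invariant : ∀ i → i < n → Valid (walk i) × remaining (walk i) + i ≡ n
  walk-invariant zero    _   = start-valid , +-identityʳ n
  walk-invariant (suc i) i<n with walk-invariant i (<-trans (n<1+n i) i<n)
  ... | v , e = step-valid (walk i) v , (begin
    remaining (walk (suc i)) + suc i   ≡⟨ +-suc _ i ⟩
    suc (remaining (step (walk i))) + i ≡⟨ cong (_+ i) (remaining-step (walk i) v two-left) ⟩
    remaining (walk i) + i             ≡⟨ e ⟩
    n                                  ∎)
    where
      open ≡-Reasoning
      two-left : 2 ≤ remaining (walk i)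
      two-left = +-cancelʳ-≤ i 2 (remaining (walk i)) (subst (suc (suc i) ≤_) (sym e) i<n)

  walk-valid : ∀ i → i < n → Valid (walk i)
  walk-valid i i<n = proj₁ (walk-invariant i i<n)

  walk-injective : ∀ i j → i < n → j < n → walk i ≡ walk j → i ≡ j
  walk-injective i j i<n j<n e = +-cancelˡ-≡ (remaining (walk i)) i j (begin
    remaining (walk i) + i ≡⟨ proj₂ (walk-invariant i i<n) ⟩
    n                      ≡⟨ sym (proj₂ (walk-invariant j j<n)) ⟩
    remaining (walk j) + j ≡⟨ cong (λ s → remaining s + j) (sym e) ⟩
    remaining (walk i) + j ∎)
    where open ≡-Reasoning

  walk-last : walk N ≡ final
  walk-last = remaining-final (walk N) (walk-valid N ≤-refl)
                (+-cancelʳ-≡ N (remaining (walk N)) 1 (proj₂ (walk-invariant N ≤-refl)))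

  walk-wraps : walk n ≡ start
  walk-wraps = cong step walk-last

  walk-firstPair : ∀ m → m + 3 ≤ k → walk (m * 3) ≡ st 0 2 (k ∸ m) atP
  walk-firstPair zero    _   = refl
  walk-firstPair (suc m) m+4≤k
    rewrite walk-firstPair m (≤-trans (n≤1+n _) m+4≤k) = lower (3<k∸m m+4≤k)
    where
      3<k∸m : ∀ {m} → suc (m + 3) ≤ k → 3 < k ∸ m
      3<k∸m {m} h = subst (_≤ k ∸ m) (trans (cong (_∸ m) (sym (+-suc m 3))) (m+n∸m≡n m 4)) (∸-monoˡ-≤ m h)
      lower : 3 < k ∸ m → afterR 0 2 (k ∸ m) ≡ st 0 2 (k ∸ suc m) atP
      lower 3<k∸m with 3 <? k ∸ m
      ... | yes _    = cong (λ r → st 0 2 r atP) (pred[m∸n]≡m∸[1+n] k m)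
      ... | no 3≮k∸m = ⊥-elim (3≮k∸m 3<k∸m)

  first-pair-fits : ∀ m → m ≤ suc K → 2 + m * 3 < n
  first-pair-fits m m≤1+K = s≤s (s≤s (begin-strict
    m * 3                                     ≤⟨ *-monoˡ-≤ 3 m≤1+K ⟩
    suc K * 3                                 <⟨ m<n+m (suc K * 3) {finalBlock} (s≤s z≤n) ⟩
    finalBlock + suc K * 3                    ≤⟨ m≤m+n _ _ ⟩
    finalBlock + suc K * 3 + 3 * triangle (suc K)
                                              ≤⟨ m≤m+n _ _ ⟩
    finalBlock + suc K * 3 + 3 * triangle (suc K) + rows (suc (suc K)) ∎))
    where open ≤-Reasoning

  word : ℕ → ℕ
  word i = letter (walk i)

  open CyclicWord N word using (before; view)

  -- Every colour 0, …, k occurs: 0 and 2 at the start, 1 at the end, and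
  -- r ≥ 3 in the first pair (0,2).
  word-onto : ∀ c → c < k + 1 → ∃ λ i → i < n × word i ≡ c
  word-onto zero                _ = 0 , s≤s z≤n , refl
  word-onto (suc zero)          _ = N , ≤-refl , cong letter walk-last
  word-onto (suc (suc zero))    _ = 1 , s≤s (s≤s z≤n) , refl
  word-onto (suc (suc (suc c))) c<k+1 = 2 + m * 3 , first-pair-fits m m≤1+K , letter-r
    where
      c≤k : suc (suc (suc c)) ≤ k
      c≤k = s≤s⁻¹ (subst (suc (suc (suc c)) <_) (+-comm k 1) c<k+1)
      m : ℕ
      m = k ∸ suc (suc (suc c))
      m≤1+K : m ≤ suc K
      m≤1+K = ∸-monoʳ-≤ {3} {suc (suc (suc c))} k (s≤s (s≤s (s≤s z≤n)))
      letter-r : word (2 + m * 3) ≡ suc (suc (suc c))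
      letter-r rewrite walk-firstPair m (subst (m + 3 ≤_) (m∸n+n≡m c≤k) (+-monoʳ-≤ m (s≤s (s≤s (s≤s z≤n)))))
        = m∸[m∸n]≡n c≤k

  before-walk : ∀ i → i < n → before i ≡ prevLetter (walk i)
  before-walk zero    _   = sym (trans (cong prevLetter (sym walk-wraps)) (prev-step (walk N) (walk-valid N ≤-refl)))
  before-walk (suc i) i<n = sym (prev-step (walk i) (walk-valid i (<-trans (n<1+n i) i<n)))

  word-locating : ∀ i j → i < n → j < n → word i ≡ word j → view i ≡ view j → i ≡ j
  word-locating i j i<n j<n same-letter same-view = walk-injective i j i<n j<n (begin
    walk i                       ≡⟨ sym (decode-view (walk i) (walk-valid i i<n)) ⟩
    decode (word i) (pair (prevLetter (walk i)) (word (suc i)))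
                                 ≡⟨ cong (λ b → decode (word i) (pair b (word (suc i)))) (sym (before-walk i i<n)) ⟩
    decode (word i) (view i)     ≡⟨ cong₂ decode same-letter same-view ⟩
    decode (word j) (view j)     ≡⟨ cong (λ b → decode (word j) (pair b (word (suc j)))) (before-walk j j<n) ⟩
    decode (word j) (pair (prevLetter (walk j)) (word (suc j)))
                                 ≡⟨ decode-view (walk j) (walk-valid j j<n) ⟩
    walk j                       ∎)
    where open ≡-Reasoning

  nl-cycle : ∃ λ (c : Fin n → Fin (k + 1)) → IsNLColoring (CycleAdj n) (k + 1) c
  nl-cycle = CyclicWord.Locating.nl-colouring N word (cong letter walk-wraps)
    (λ i i<n → next-differs (walk i) (walk-valid i i<n))
    (λ i i<n → subst (word i <_) (+-comm 1 k) (s≤s (letter-≤k (walk i) (walk-valid i i<n))))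
    word-onto word-locating

  cycle-length-double : k ^ 2 + suc n * 2 ≡ k ^ 3
  cycle-length-double = begin
    k ^ 2 + suc n * 2
      ≡⟨ expand K (triangle (suc K)) (rows (suc (suc K))) ⟩
    k * k + 24 + 10 * K + 3 * (2 * triangle (suc K)) + 2 * rows (suc (suc K))
      ≡⟨ cong₂ (λ x y → k * k + 24 + 10 * K + 3 * x + y) (triangle-double (suc K)) (rows-double (suc K)) ⟩
    k * k + 24 + 10 * K + 3 * (suc K * suc (suc K)) + (2 * suc (suc K) * suc (suc (suc K)) + suc (suc (suc K)) * suc (suc K) * suc K)
      ≡⟨ cube K ⟩
    k ^ 3 ∎
    where
      open ≡-Reasoning
      expand : ∀ K T B → (4 + K) * ((4 + K) * 1) + suc (2 + (6 + K + K + suc K * 3 + 3 * T + B)) * 2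
                         ≡ (4 + K) * (4 + K) + 24 + 10 * K + 3 * (2 * T) + 2 * B
      expand = solve-∀
      cube : ∀ K → (4 + K) * (4 + K) + 24 + 10 * K + 3 * (suc K * suc (suc K))
                   + (2 * suc (suc K) * suc (suc (suc K)) + suc (suc (suc K)) * suc (suc K) * suc K)
                   ≡ (4 + K) * ((4 + K) * ((4 + K) * 1))
      cube = solve-∀

  cycle-length : ℓ k ∸ 1 ≡ n
  cycle-length = cong pred (begin
    (k ^ 3 ∸ k ^ 2) / 2               ≡⟨ cong (λ x → (x ∸ k ^ 2) / 2) (sym cycle-length-double) ⟩
    (k ^ 2 + suc n * 2 ∸ k ^ 2) / 2   ≡⟨ cong (_/ 2) (m+n∸m≡n (k ^ 2) (suc n * 2)) ⟩
    suc n * 2 / 2                     ≡⟨ m*n/n≡m (suc n) 2 ⟩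
    suc n                             ∎)
    where open ≡-Reasoning

lemma16 : (k : ℕ) → k ≥ 4 →
    ∃ λ (c : Fin (ℓ k ∸ 1) → Fin (k + 1)) → IsNLColoring (CycleAdj (ℓ k ∸ 1)) (k + 1) c
lemma16 (suc (suc (suc (suc K)))) (s≤s (s≤s (s≤s (s≤s z≤n)))) =
  subst (λ m → ∃ λ (c : Fin m → Fin (k + 1)) → IsNLColoring (CycleAdj m) (k + 1) c)
        (sym cycle-length) nl-cycle
  where open Construction K
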